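{- Let $n\ge1$, $m\ge1$ and let $\mathcal{B}$ be a Boolean algebra with $2^m$ elements. Then $B^{\mathcal{B}}_n$ has exactly $(n+2)^m$ elements.
   Context: For a Boolean algebra $\mathcal{B}$ and $n\ge1$, $B^{\mathcal{B}}_n=\{z\in|\mathcal{B}|^{n+1}: (\bigwedge_{i=1}^k z_{[i]})\vee z_{[k+1]}=1 \text{ for all } 1\le k\le n\}$, where $z_{[i]}$ is the $i$-th coordinate of $z$. -}

module Defs where

open import Level using (Level; _⊔_)
open import Data.Nat using (ℕ; zero; suc)
open import Data.Fin using (Fin; zero; suc)
open import Data.Product using (Σ; proj₁)
open import Relation.Binary.Bundles using (Setoid)
open import Relation.Binary.PropositionalEquality as ≡ using ()
open import Function.Bundles using (Bijection)
open import Algebra.Lattice.Bundles using (BooleanAlgebra)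

HasCard : ∀ {a ℓ} → Setoid a ℓ → ℕ → Set (a ⊔ ℓ)
HasCard S k = Bijection S (≡.setoid (Fin k))

module _ {c ℓ} (𝓑 : BooleanAlgebra c ℓ) where
  open BooleanAlgebra 𝓑

  -- An element z of |B|^(n+1) is a function Fin (suc n) → Carrier;
  -- coordinate z_[i] (1-based) is z (i-1) here (0-based).
  -- prefMeet z k  =  z_[1] ∧ ... ∧ z_[k+1]   for k : Fin n (0-based k).
  prefMeet : ∀ {n} → (Fin (suc n) → Carrier) → Fin n → Carrier
  prefMeet z zero    = z zero
  prefMeet z (suc k) = z zero ∧ prefMeet (λ i → z (suc i)) k

  -- Membership in B^𝓑_n: for all 1 ≤ k ≤ n, (⋀_{i=1}^k z_[i]) ∨ z_[k+1] = 1.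
  -- (k ranges over Fin n, encoding k+1 in the paper's 1-based convention.)
  InB : (n : ℕ) → (Fin (suc n) → Carrier) → Set ℓ
  InB n z = (k : Fin n) → (prefMeet z k ∨ z (suc k)) ≈ ⊤

  Bset : ℕ → Setoid (c ⊔ ℓ) ℓ
  Bset n = record
    { Carrier = Σ (Fin (suc n) → Carrier) (InB n)
    ; _≈_ = λ x y → (i : Fin (suc n)) → proj₁ x i ≈ proj₁ y i
    ; isEquivalence = record
      { refl = λ i → Eq.refl
      ; sym = λ p i → Eq.sym (p i)
      ; trans = λ p q i → Eq.trans (p i) (q i)
      }
    }
    where module Eq = Setoid setoid

-- A finite Boolean algebra is isomorphic to 𝔹ᵏ, k its number of atoms, via x ↦ (atoms below x);
-- hence |B| = 2ᵏ forces k = m. The isomorphism preserves ∧, ∨ and ⊤, so the defining equations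
-- of B_n hold iff they hold in every coordinate, i.e. B_n ≅ (B_n over 𝔹)ᵐ. Over 𝔹 the equations
-- say that a sequence contains at most one false, and there are n + 2 such sequences of length n + 1.
module Submission where

open import Defs
open import Level using (0ℓ; _⊔_)
open import Data.Nat as ℕ using (ℕ; zero; suc; _+_; _^_; s≤s; z≤n)
import Data.Nat.Properties as ℕ
open import Data.Fin as Fin using (Fin; zero; suc; combine; funToFin; finToFun)
import Data.Fin.Properties as Fin
open import Data.Fin.Induction using (spo-wellFounded)
open import Data.Fin.Permutation using (↔⇒≡)
open import Data.Bool as Bool using (Bool; true; false; if_then_else_)
open import Data.Bool.Properties using (∨-∧-booleanAlgebra)
open import Data.List using (List; length; lookup; filter; allFin)
open import Data.List.Membership.Propositional.Properties using (∈-filter⁺; ∈-filter⁻; ∈-lookup; ∈-allFin)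
open import Data.List.Relation.Unary.Any using (index)
open import Data.List.Relation.Unary.Any.Properties using (lookup-index)
import Data.List.Relation.Unary.All as All
open import Data.List.Relation.Unary.AllPairs using (_∷_)
open import Data.List.Relation.Unary.Unique.Propositional using (Unique)
import Data.List.Relation.Unary.Unique.Propositional.Properties as Unique
open import Data.Product as Product using (∃; _×_; _,_; proj₁; proj₂)
open import Data.Sum as Sum using (_⊎_; inj₁; inj₂; [_,_])
open import Data.Vec.Functional using (Vector; foldr)
import Data.Vec.Functional.Relation.Binary.Equality.Setoid as Pointwise
open import Function using (_∘_; id)
open import Function.Bundles using (Inverse; Injection; mk⇔)
open import Function.Properties.Inverse using (Inverse⇒Bijection; Inverse⇒Injection)
open import Function.Properties.Bijection using (Bijection⇒Inverse)
import Function.Construct.Composition as Composition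
import Function.Construct.Symmetry as Symmetry
open import Induction.WellFounded using (WellFounded; Acc; acc; module Subrelation)
open import Algebra.Lattice.Bundles using (BooleanAlgebra)
import Algebra.Lattice.Properties.BooleanAlgebra as BooleanAlgebraProperties
open import Relation.Binary using (Setoid; Rel; Decidable; IsStrictPartialOrder; _Respects_; tri<; tri≈; tri>)
import Relation.Binary.Construct.On as On
import Relation.Binary.Lattice as OrderTheoretic
import Relation.Binary.Properties.Poset as PosetProperties
open import Relation.Binary.PropositionalEquality as ≡ using (_≡_; _≢_; _≗_)
open import Relation.Nullary using (Dec; yes; no; does; ¬?)
open import Relation.Nullary.Decidable as Dec using (_×-dec_; _⊎-dec_; _→-dec_; dec-true; dec-false; does-⇔)
open import Relation.Nullary.Negation using (contradiction)
open import Relation.Unary using (Pred)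

module FiniteSetoid {a ℓ} {S : Setoid a ℓ} {N : ℕ} (finite : Inverse S (≡.setoid (Fin N))) where
  open Setoid S
  open Inverse finite

  from-injective : ∀ {i j} → from i ≈ from j → i ≡ j
  from-injective {i} {j} eq =
    ≡.trans (≡.sym (strictlyInverseˡ i)) (≡.trans (to-cong eq) (strictlyInverseˡ j))

  _≟_ : Decidable _≈_
  x ≟ y = Dec.map′ (Injection.injective (Inverse⇒Injection finite)) to-cong (to x Fin.≟ to y)

  module _ {p} {P : Pred Carrier p} (resp : P Respects _≈_) (P? : ∀ x → Dec (P x)) where

    all? : Dec (∀ x → P x)
    all? = Dec.map′ (λ ∀P x → resp (strictlyInverseʳ x) (∀P (to x))) (λ ∀P → ∀P ∘ from)
                    (Fin.all? (P? ∘ from))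

    any? : Dec (∃ P)
    any? = Dec.map′ (Product.map from id) (λ (x , px) → to x , resp (sym (strictlyInverseʳ x)) px)
                    (Fin.any? (P? ∘ from))

  strictPartialOrder-wellFounded : ∀ {r} {_<_ : Rel Carrier r} →
    IsStrictPartialOrder _≈_ _<_ → WellFounded _<_
  strictPartialOrder-wellFounded {_<_ = _<_} spo =
    Subrelation.wellFounded through-from∘to
      (On.wellFounded to (spo-wellFounded (On.isStrictPartialOrder from spo)))
    where
    open IsStrictPartialOrder spo using (<-respˡ-≈; <-respʳ-≈)
    through-from∘to : ∀ {x y} → x < y → from (to x) < from (to y)
    through-from∘to = <-respˡ-≈ (sym (strictlyInverseʳ _)) ∘ <-respʳ-≈ (sym (strictlyInverseʳ _))

module _ {a b ℓ₁ ℓ₂} {S : Setoid a ℓ₁} {T : Setoid b ℓ₂} (f : Inverse S T) where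
  open Inverse f

  pointwise-inverse : ∀ k → Inverse (Pointwise.≋-setoid S k) (Pointwise.≋-setoid T k)
  pointwise-inverse k = record
    { to        = to ∘_
    ; from      = from ∘_
    ; to-cong   = to-cong ∘_
    ; from-cong = from-cong ∘_
    ; inverse   = (λ eq → inverseˡ ∘ eq) , (λ eq → inverseʳ ∘ eq)
    }

funToFin-cong : ∀ {m n} {f g : Fin m → Fin n} → f ≗ g → funToFin f ≡ funToFin g
funToFin-cong {zero}  eq = ≡.refl
funToFin-cong {suc m} eq = ≡.cong₂ combine (eq zero) (funToFin-cong (eq ∘ suc))

funToFin-inverse : ∀ b k → Inverse (Pointwise.≋-setoid (≡.setoid (Fin b)) k) (≡.setoid (Fin (b ^ k)))
funToFin-inverse b k = record
  { to        = funToFin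
  ; from      = finToFun
  ; to-cong   = funToFin-cong
  ; from-cong = λ { ≡.refl _ → ≡.refl }
  ; inverse   = (λ eq → ≡.trans (funToFin-cong eq) (Fin.funToFin-finToFin {k} {b} _))
              , (λ { ≡.refl → Fin.finToFun-funToFin _ })
  }

^-inverse : ∀ {a ℓ} {S : Setoid a ℓ} {b} → Inverse S (≡.setoid (Fin b)) →
  ∀ k → Inverse (Pointwise.≋-setoid S k) (≡.setoid (Fin (b ^ k)))
^-inverse {b = b} f k = Composition.inverse (pointwise-inverse f k) (funToFin-inverse b k)

^-injectiveʳ : ∀ b → 1 ℕ.< b → ∀ {k m} → b ^ k ≡ b ^ m → k ≡ m
^-injectiveʳ b 1<b {k} {m} bᵏ≡bᵐ with ℕ.<-cmp k m
... | tri< k<m _ _ = contradiction bᵏ≡bᵐ (ℕ.<⇒≢ (ℕ.^-monoʳ-< b 1<b k<m))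
... | tri≈ _ k≡m _ = k≡m
... | tri> _ _ m<k = contradiction bᵏ≡bᵐ (ℕ.>⇒≢ (ℕ.^-monoʳ-< b 1<b m<k))

lookup-injective : ∀ {a} {A : Set a} {xs : List A} → Unique xs →
  ∀ {i j} → lookup xs i ≡ lookup xs j → i ≡ j
lookup-injective (_    ∷ _) {zero}  {zero}  _  = ≡.refl
lookup-injective (x∉xs ∷ _) {zero}  {suc j} eq = contradiction eq (All.lookup x∉xs (∈-lookup j))
lookup-injective (x∉xs ∷ _) {suc i} {zero}  eq = contradiction (≡.sym eq) (All.lookup x∉xs (∈-lookup i))
lookup-injective (_    ∷ u) {suc i} {suc j} eq = ≡.cong suc (lookup-injective u eq)

𝔹 : BooleanAlgebra 0ℓ 0ℓ
𝔹 = ∨-∧-booleanAlgebra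

leadingTrues : ∀ {n} → (Fin n → Bool) → Fin (suc n)
leadingTrues {zero}  z = zero
leadingTrues {suc n} z = if z zero then suc (leadingTrues (z ∘ suc)) else zero

-- The elements of Bset 𝔹 n are the sequences with at most one false; trueExcept x has its false
-- at position x, or none when x is the last element of Fin (suc (suc n)).
trueExcept : ∀ {n} → Fin (suc n) → Fin n → Bool
trueExcept zero    zero    = false
trueExcept zero    (suc i) = true
trueExcept (suc x) zero    = true
trueExcept (suc x) (suc i) = trueExcept x i

leadingTrues-cong : ∀ {n} {z z′ : Fin n → Bool} → z ≗ z′ → leadingTrues z ≡ leadingTrues z′
leadingTrues-cong {zero}  _  = ≡.refl
leadingTrues-cong {suc n} eq =
  ≡.cong₂ (λ b t → if b then suc t else zero) (eq zero) (leadingTrues-cong (eq ∘ suc))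

leadingTrues-trueExcept : ∀ {n} (x : Fin (suc n)) → leadingTrues (trueExcept x) ≡ x
leadingTrues-trueExcept {zero}  zero    = ≡.refl
leadingTrues-trueExcept {suc n} zero    = ≡.refl
leadingTrues-trueExcept {suc n} (suc x) = ≡.cong suc (leadingTrues-trueExcept x)

trueExcept-valid : ∀ {n} (x : Fin (suc (suc n))) → InB 𝔹 n (trueExcept x)
trueExcept-valid zero    zero    = ≡.refl
trueExcept-valid zero    (suc k) = ≡.refl
trueExcept-valid (suc x) zero    = ≡.refl
trueExcept-valid (suc x) (suc k) = trueExcept-valid x k

prefMeet-false : ∀ {n} (z : Fin (suc n) → Bool) → z zero ≡ false → ∀ k → prefMeet 𝔹 z k ≡ false
prefMeet-false z z₀≡false zero    = z₀≡false
prefMeet-false z z₀≡false (suc k) = ≡.cong (Bool._∧ prefMeet 𝔹 (z ∘ suc) k) z₀≡false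

InB-tail : ∀ {n} (z : Fin (suc (suc n)) → Bool) → z zero ≡ true → InB 𝔹 (suc n) z → InB 𝔹 n (z ∘ suc)
InB-tail z z₀≡true valid k =
  ≡.subst (λ b → ((b Bool.∧ prefMeet 𝔹 (z ∘ suc) k) Bool.∨ z (suc (suc k))) ≡ true)
          z₀≡true (valid (suc k))

trueExcept-leadingTrues : ∀ {n} (z : Fin (suc n) → Bool) → InB 𝔹 n z → trueExcept (leadingTrues z) ≗ z
trueExcept-leadingTrues {zero} z valid zero with z zero
... | true  = ≡.refl
... | false = ≡.refl
trueExcept-leadingTrues {suc n} z valid i with z zero in z₀
trueExcept-leadingTrues {suc n} z valid zero    | true  = ≡.sym z₀
trueExcept-leadingTrues {suc n} z valid (suc i) | true  =
  trueExcept-leadingTrues (z ∘ suc) (InB-tail z z₀ valid) i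
trueExcept-leadingTrues {suc n} z valid zero    | false = ≡.sym z₀
trueExcept-leadingTrues {suc n} z valid (suc i) | false =
  ≡.sym (≡.subst (λ b → (b Bool.∨ z (suc i)) ≡ true) (prefMeet-false z z₀ i) (valid i))

Bset𝔹-inverse : ∀ n → Inverse (Bset 𝔹 n) (≡.setoid (Fin (suc (suc n))))
Bset𝔹-inverse n = record
  { to        = leadingTrues ∘ proj₁
  ; from      = λ x → trueExcept x , trueExcept-valid x
  ; to-cong   = leadingTrues-cong
  ; from-cong = λ { ≡.refl _ → ≡.refl }
  ; inverse   = (λ {x} eq → ≡.trans (leadingTrues-cong eq) (leadingTrues-trueExcept x))
              , (λ { {z , valid} ≡.refl → trueExcept-leadingTrues z valid })
  }

-- Order and atoms in a Boolean algebra

module Atoms {c ℓ} (𝓑 : BooleanAlgebra c ℓ) where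
  open BooleanAlgebra 𝓑
  open BooleanAlgebraProperties 𝓑 using (∨-∧-orderTheoreticLattice; ∧-identityʳ; ∧-zeroˡ; ∧-zeroʳ; ∨-identityʳ)
  open OrderTheoretic.Lattice ∨-∧-orderTheoreticLattice public
    using (_≤_; poset; x≤x∨y; y≤x∨y; ∨-least; x∧y≤x; x∧y≤y; ∧-greatest; ≤-respˡ-≈; ≤-respʳ-≈)
    renaming (refl to ≤-refl; reflexive to ≤-reflexive; trans to ≤-trans; antisym to ≤-antisym)
  open import Relation.Binary.Reasoning.Setoid setoid

  ⊥≤ : ∀ x → ⊥ ≤ x
  ⊥≤ x = sym (∧-zeroˡ x)

  ≤⊤ : ∀ x → x ≤ ⊤
  ≤⊤ x = sym (∧-identityʳ x)

  ≤⊥⇒≈⊥ : ∀ {x} → x ≤ ⊥ → x ≈ ⊥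
  ≤⊥⇒≈⊥ {x} x≤⊥ = trans x≤⊥ (∧-zeroʳ x)

  x∧¬y≈⊥⇒x≤y : ∀ {x y} → x ∧ ¬ y ≈ ⊥ → x ≤ y
  x∧¬y≈⊥⇒x≤y {x} {y} x∧¬y≈⊥ = sym (begin
    x ∧ y             ≈⟨ ∨-identityʳ _ ⟨
    x ∧ y ∨ ⊥         ≈⟨ ∨-congˡ x∧¬y≈⊥ ⟨
    x ∧ y ∨ x ∧ ¬ y   ≈⟨ ∧-distribˡ-∨ x y (¬ y) ⟨
    x ∧ (y ∨ ¬ y)     ≈⟨ ∧-congˡ (∨-complementʳ y) ⟩
    x ∧ ⊤             ≈⟨ ∧-identityʳ x ⟩
    x                 ∎)

  ≤-and-≤¬⇒≈⊥ : ∀ {x y} → x ≤ y → x ≤ ¬ y → x ≈ ⊥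
  ≤-and-≤¬⇒≈⊥ {y = y} x≤y x≤¬y =
    ≤⊥⇒≈⊥ (≤-trans (∧-greatest x≤y x≤¬y) (≤-reflexive (∧-complementʳ y)))

  ⋁ : ∀ {k} → Vector Carrier k → Carrier
  ⋁ = foldr _∨_ ⊥

  ≤-⋁ : ∀ {k} (f : Vector Carrier k) i → f i ≤ ⋁ f
  ≤-⋁ f zero    = x≤x∨y (f zero) (⋁ (f ∘ suc))
  ≤-⋁ f (suc i) = ≤-trans (≤-⋁ (f ∘ suc) i) (y≤x∨y (f zero) (⋁ (f ∘ suc)))

  ⋁-least : ∀ {k} {f : Vector Carrier k} {y} → (∀ i → f i ≤ y) → ⋁ f ≤ y
  ⋁-least {zero}  _    = ⊥≤ _
  ⋁-least {suc k} f≤y = ∨-least (f≤y zero) (⋁-least (f≤y ∘ suc))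

  IsAtom : Pred Carrier (c ⊔ ℓ)
  IsAtom a = a ≉ ⊥ × (∀ y → y ≤ a → y ≈ ⊥ ⊎ y ≈ a)

  IsAtom-resp : IsAtom Respects _≈_
  IsAtom-resp a≈b (a≉⊥ , below-a) =
    a≉⊥ ∘ trans a≈b ,
    λ y y≤b → Sum.map₂ (λ y≈a → trans y≈a a≈b) (below-a y (≤-respʳ-≈ (sym a≈b) y≤b))

  atom-prime : ∀ {a x y} → IsAtom a → a ≤ x ∨ y → a ≤ x ⊎ a ≤ y
  atom-prime {a} {x} {y} (a≉⊥ , below-a) a≤x∨y
    with below-a (a ∧ x) (x∧y≤x a x) | below-a (a ∧ y) (x∧y≤x a y)
  ... | inj₂ a∧x≈a | _          = inj₁ (sym a∧x≈a)
  ... | inj₁ _     | inj₂ a∧y≈a = inj₂ (sym a∧y≈a)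
  ... | inj₁ a∧x≈⊥ | inj₁ a∧y≈⊥ = contradiction (begin
    a                 ≈⟨ a≤x∨y ⟩
    a ∧ (x ∨ y)       ≈⟨ ∧-distribˡ-∨ a x y ⟩
    a ∧ x ∨ a ∧ y     ≈⟨ ∨-cong a∧x≈⊥ a∧y≈⊥ ⟩
    ⊥ ∨ ⊥             ≈⟨ ∨-identityʳ ⊥ ⟩
    ⊥                 ∎) a≉⊥

  atom-prime-⋁ : ∀ {k a} {f : Vector Carrier k} → IsAtom a → a ≤ ⋁ f → ∃ λ i → a ≤ f i
  atom-prime-⋁ {zero}  (a≉⊥ , _) a≤⊥ = contradiction (≤⊥⇒≈⊥ a≤⊥) a≉⊥
  atom-prime-⋁ {suc k} atom a≤⋁ with atom-prime atom a≤⋁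
  ... | inj₁ a≤f₀ = zero , a≤f₀
  ... | inj₂ a≤⋁f = Product.map suc id (atom-prime-⋁ atom a≤⋁f)

  atom-≤⇒≈ : ∀ {a b} → IsAtom a → IsAtom b → a ≤ b → a ≈ b
  atom-≤⇒≈ (a≉⊥ , _) (_ , below-b) a≤b with below-b _ a≤b
  ... | inj₁ a≈⊥ = contradiction a≈⊥ a≉⊥
  ... | inj₂ a≈b = a≈b

-- Boolean algebras isomorphic to a power of 𝔹

record BoolPowerRepresentation {c ℓ} (𝓑 : BooleanAlgebra c ℓ) (k : ℕ) : Set (c ⊔ ℓ) where
  open BooleanAlgebra 𝓑
  field
    iso : Inverse setoid (Pointwise.≋-setoid (≡.setoid Bool) k)
  open Inverse iso public
  field
    to-∧ : ∀ x y j → to (x ∧ y) j ≡ to x j Bool.∧ to y j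
    to-∨ : ∀ x y j → to (x ∨ y) j ≡ to x j Bool.∨ to y j
    to-⊤ : ∀ j → to ⊤ j ≡ true

module FiniteBooleanAlgebra {c ℓ} (𝓑 : BooleanAlgebra c ℓ) {N}
  (finite : Inverse (BooleanAlgebra.setoid 𝓑) (≡.setoid (Fin N))) where
  open BooleanAlgebra 𝓑
  open Atoms 𝓑
  open FiniteSetoid finite
  open Inverse finite using (to; from; strictlyInverseʳ)
  open PosetProperties poset using (_<_; <-isStrictPartialOrder)
  open IsStrictPartialOrder <-isStrictPartialOrder using (<-respˡ-≈)

  _≤?_ : Decidable _≤_
  x ≤? y = x ≟ (x ∧ y)

  isAtom? : ∀ a → Dec (IsAtom a)
  isAtom? a = ¬? (a ≟ ⊥) ×-dec all? resp (λ y → y ≤? a →-dec (y ≟ ⊥ ⊎-dec y ≟ a))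
    where
    resp : (λ y → y ≤ a → y ≈ ⊥ ⊎ y ≈ a) Respects _≈_
    resp y≈z below z≤a = Sum.map (trans (sym y≈z)) (trans (sym y≈z)) (below (≤-respˡ-≈ (sym y≈z) z≤a))

  -- Descend through proper nonzero elements below x; this terminates because 𝓑 is finite.
  atom-below : ∀ x → x ≉ ⊥ → ∃ λ a → IsAtom a × a ≤ x
  atom-below x = go x (strictPartialOrder-wellFounded <-isStrictPartialOrder x)
    where
    go : ∀ x → Acc _<_ x → x ≉ ⊥ → ∃ λ a → IsAtom a × a ≤ x
    go x (acc smaller) x≉⊥
      with any? (λ y≈z (y<x , y≉⊥) → <-respˡ-≈ y≈z y<x , y≉⊥ ∘ trans y≈z)
                (λ y → (y ≤? x ×-dec ¬? (y ≟ x)) ×-dec ¬? (y ≟ ⊥))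
    ... | yes (y , y<x , y≉⊥) =
      let a , isAtom , a≤y = go y (smaller y<x) y≉⊥ in a , isAtom , ≤-trans a≤y (proj₁ y<x)
    ... | no ∄smaller = x , (x≉⊥ , trivial) , ≤-refl
      where
      trivial : ∀ y → y ≤ x → y ≈ ⊥ ⊎ y ≈ x
      trivial y y≤x with y ≟ ⊥ | y ≟ x
      ... | yes y≈⊥ | _       = inj₁ y≈⊥
      ... | no _    | yes y≈x = inj₂ y≈x
      ... | no y≉⊥  | no y≉x  = contradiction (y , (y≤x , y≉x) , y≉⊥) ∄smaller

  ≤-via-atoms : ∀ {x y} → (∀ a → IsAtom a → a ≤ x → a ≤ y) → x ≤ y
  ≤-via-atoms {x} {y} atoms≤ with (x ∧ ¬ y) ≟ ⊥
  ... | yes x∧¬y≈⊥ = x∧¬y≈⊥⇒x≤y x∧¬y≈⊥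
  ... | no x∧¬y≉⊥ =
    let a , isAtom , a≤x∧¬y = atom-below _ x∧¬y≉⊥ in
    contradiction (≤-and-≤¬⇒≈⊥ (atoms≤ a isAtom (≤-trans a≤x∧¬y (x∧y≤x x (¬ y))))
                               (≤-trans a≤x∧¬y (x∧y≤y x (¬ y))))
                  (proj₁ isAtom)

  atomCodes : List (Fin N)
  atomCodes = filter (isAtom? ∘ from) (allFin N)

  numberOfAtoms : ℕ
  numberOfAtoms = length atomCodes

  atom : Fin numberOfAtoms → Carrier
  atom j = from (lookup atomCodes j)

  atom-isAtom : ∀ j → IsAtom (atom j)
  atom-isAtom j = proj₂ (∈-filter⁻ (isAtom? ∘ from) {xs = allFin N} (∈-lookup j))

  atom-injective : ∀ {i j} → atom i ≈ atom j → i ≡ j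
  atom-injective = lookup-injective (Unique.filter⁺ (isAtom? ∘ from) (Unique.allFin⁺ N)) ∘ from-injective

  atom-surjective : ∀ {a} → IsAtom a → ∃ λ j → a ≈ atom j
  atom-surjective {a} isAtom =
    index a∈atoms , trans (sym (strictlyInverseʳ a)) (reflexive (≡.cong from (lookup-index a∈atoms)))
    where
    a∈atoms = ∈-filter⁺ (isAtom? ∘ from) (∈-allFin (to a)) (IsAtom-resp (sym (strictlyInverseʳ a)) isAtom)

  toBits : Carrier → Vector Bool numberOfAtoms
  toBits x j = does (atom j ≤? x)

  select : Vector Bool numberOfAtoms → Vector Carrier numberOfAtoms
  select v j = if v j then atom j else ⊥

  fromBits : Vector Bool numberOfAtoms → Carrier
  fromBits v = ⋁ (select v)

  atom≤select : ∀ {v j} → v j ≡ true → atom j ≤ select v j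
  atom≤select vj rewrite vj = ≤-refl

  atom≤select⇒ : ∀ {v i j} → atom i ≤ select v j → v j ≡ true × i ≡ j
  atom≤select⇒ {v} {i} {j} ai≤ with v j
  ... | true  = ≡.refl , atom-injective (atom-≤⇒≈ (atom-isAtom i) (atom-isAtom j) ai≤)
  ... | false = contradiction (≤⊥⇒≈⊥ ai≤) (proj₁ (atom-isAtom i))

  toBits-cong : ∀ {x y} → x ≈ y → toBits x ≗ toBits y
  toBits-cong x≈y j = does-⇔ (mk⇔ (≤-respʳ-≈ x≈y) (≤-respʳ-≈ (sym x≈y))) (atom j ≤? _) (atom j ≤? _)

  toBits-∧ : ∀ x y j → toBits (x ∧ y) j ≡ toBits x j Bool.∧ toBits y j
  toBits-∧ x y j = does-⇔ (mk⇔ (λ a≤x∧y → ≤-trans a≤x∧y (x∧y≤x x y) , ≤-trans a≤x∧y (x∧y≤y x y))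
                                 (λ (a≤x , a≤y) → ∧-greatest a≤x a≤y))
                          (atom j ≤? (x ∧ y)) (atom j ≤? x ×-dec atom j ≤? y)

  toBits-∨ : ∀ x y j → toBits (x ∨ y) j ≡ toBits x j Bool.∨ toBits y j
  toBits-∨ x y j = does-⇔ (mk⇔ (atom-prime (atom-isAtom j))
                                 [ (λ a≤x → ≤-trans a≤x (x≤x∨y x y)) , (λ a≤y → ≤-trans a≤y (y≤x∨y x y)) ])
                          (atom j ≤? (x ∨ y)) (atom j ≤? x ⊎-dec atom j ≤? y)

  toBits-⊤ : ∀ j → toBits ⊤ j ≡ true
  toBits-⊤ j = dec-true (atom j ≤? ⊤) (≤⊤ (atom j))

  toBits-fromBits : ∀ v → toBits (fromBits v) ≗ v
  toBits-fromBits v j with v j in vj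
  ... | true  = dec-true (atom j ≤? fromBits v) (≤-trans (atom≤select {v} vj) (≤-⋁ (select v) j))
  ... | false = dec-false (atom j ≤? fromBits v) λ aj≤ →
    let i , aj≤select = atom-prime-⋁ {f = select v} (atom-isAtom j) aj≤
        vi , j≡i = atom≤select⇒ {v} aj≤select
    in true≢false (≡.trans (≡.sym vi) (≡.trans (≡.cong v (≡.sym j≡i)) vj))
    where
    true≢false : true ≢ false
    true≢false ()

  fromBits-toBits : ∀ x → fromBits (toBits x) ≈ x
  fromBits-toBits x = ≤-antisym (⋁-least select≤x) (≤-via-atoms atom≤fromBits)
    where
    select≤x : ∀ j → select (toBits x) j ≤ x
    select≤x j = if-≤ (atom j ≤? x)
      where
      if-≤ : (d : Dec (atom j ≤ x)) → (if does d then atom j else ⊥) ≤ x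
      if-≤ (yes aj≤x) = aj≤x
      if-≤ (no  _)    = ⊥≤ x
    atom≤fromBits : ∀ a → IsAtom a → a ≤ x → a ≤ fromBits (toBits x)
    atom≤fromBits a isAtom a≤x =
      let j , a≈aj = atom-surjective isAtom in
      ≤-respˡ-≈ (sym a≈aj) (≤-trans (atom≤select {toBits x} (dec-true (atom j ≤? x) (≤-respˡ-≈ a≈aj a≤x)))
                                    (≤-⋁ (select (toBits x)) j))

  fromBits-cong : ∀ {v w} → v ≗ w → fromBits v ≈ fromBits w
  fromBits-cong v≗w =
    foldr-cong ∨-cong refl λ j → reflexive (≡.cong (λ b → if b then atom j else ⊥) (v≗w j))
    where open Pointwise setoid using (foldr-cong)

  toBits-inverse : Inverse setoid (Pointwise.≋-setoid (≡.setoid Bool) numberOfAtoms)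
  toBits-inverse = record
    { to        = toBits
    ; from      = fromBits
    ; to-cong   = toBits-cong
    ; from-cong = fromBits-cong
    ; inverse   = (λ {v} x≈v j → ≡.trans (toBits-cong x≈v j) (toBits-fromBits v j))
                , (λ {x} v≗x → trans (fromBits-cong v≗x) (fromBits-toBits x))
    }

  representation : BoolPowerRepresentation 𝓑 numberOfAtoms
  representation = record
    { iso = toBits-inverse ; to-∧ = toBits-∧ ; to-∨ = toBits-∨ ; to-⊤ = toBits-⊤ }

  size≡2^numberOfAtoms : N ≡ 2 ^ numberOfAtoms
  size≡2^numberOfAtoms = ↔⇒≡ (Composition.inverse (Symmetry.inverse finite)
    (Composition.inverse toBits-inverse (^-inverse (Symmetry.inverse Fin.2↔Bool) numberOfAtoms)))

-- B_n coordinatewise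

module _ {c ℓ} (𝓑 : BooleanAlgebra c ℓ) where
  open BooleanAlgebra 𝓑

  prefMeet-cong : ∀ {n} {z z′ : Fin (suc n) → Carrier} → (∀ i → z i ≈ z′ i) →
    ∀ l → prefMeet 𝓑 z l ≈ prefMeet 𝓑 z′ l
  prefMeet-cong z≈z′ zero    = z≈z′ zero
  prefMeet-cong z≈z′ (suc l) = ∧-cong (z≈z′ zero) (prefMeet-cong (z≈z′ ∘ suc) l)

  InB-resp : ∀ {n} {z z′ : Fin (suc n) → Carrier} → (∀ i → z i ≈ z′ i) → InB 𝓑 n z → InB 𝓑 n z′
  InB-resp z≈z′ valid l = trans (sym (∨-cong (prefMeet-cong z≈z′ l) (z≈z′ (suc l)))) (valid l)

module _ {c ℓ} {𝓑 : BooleanAlgebra c ℓ} {k} (rep : BoolPowerRepresentation 𝓑 k) where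
  open BooleanAlgebra 𝓑
  open BoolPowerRepresentation rep
  open ≡.≡-Reasoning

  column : ∀ {n} → (Fin (suc n) → Carrier) → Fin k → Fin (suc n) → Bool
  column z j i = to (z i) j

  to-prefMeet : ∀ {n} (z : Fin (suc n) → Carrier) l j → to (prefMeet 𝓑 z l) j ≡ prefMeet 𝔹 (column z j) l
  to-prefMeet z zero    j = ≡.refl
  to-prefMeet z (suc l) j = ≡.trans (to-∧ _ _ j) (≡.cong (to (z zero) j Bool.∧_) (to-prefMeet (z ∘ suc) l j))

  to-InB-condition : ∀ {n} (z : Fin (suc n) → Carrier) l j →
    to (prefMeet 𝓑 z l ∨ z (suc l)) j ≡ (prefMeet 𝔹 (column z j) l Bool.∨ column z j (suc l))
  to-InB-condition z l j = ≡.trans (to-∨ _ _ j) (≡.cong (Bool._∨ column z j (suc l)) (to-prefMeet z l j))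

  InB-column : ∀ {n z} → InB 𝓑 n z → ∀ j → InB 𝔹 n (column z j)
  InB-column {z = z} valid j l = begin
    prefMeet 𝔹 (column z j) l Bool.∨ column z j (suc l)  ≡⟨ to-InB-condition z l j ⟨
    to (prefMeet 𝓑 z l ∨ z (suc l)) j                    ≡⟨ to-cong (valid l) j ⟩
    to ⊤ j                                               ≡⟨ to-⊤ j ⟩
    true                                                 ∎

  InB-columns : ∀ {n z} → (∀ j → InB 𝔹 n (column z j)) → InB 𝓑 n z
  InB-columns {z = z} valid l = Injection.injective (Inverse⇒Injection iso) λ j → begin
    to (prefMeet 𝓑 z l ∨ z (suc l)) j                    ≡⟨ to-InB-condition z l j ⟩
    prefMeet 𝔹 (column z j) l Bool.∨ column z j (suc l)  ≡⟨ valid j l ⟩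
    true                                                 ≡⟨ to-⊤ j ⟨
    to ⊤ j                                               ∎

  Bset-inverse : ∀ n → Inverse (Bset 𝓑 n) (Pointwise.≋-setoid (Bset 𝔹 n) k)
  Bset-inverse n = record
    { to        = λ (z , valid) j → column z j , InB-column valid j
    ; from      = λ w → rows w ,
                    InB-columns λ j → InB-resp 𝔹 (λ i → ≡.sym (strictlyInverseˡ _ j)) (proj₂ (w j))
    ; to-cong   = λ z≈z′ j i → to-cong (z≈z′ i) j
    ; from-cong = λ w≈w′ i → from-cong λ j → w≈w′ j i
    ; inverse   = (λ z≈ j i → inverseˡ (z≈ i) j) , (λ w≈ i → inverseʳ λ j → w≈ j i)
    }
    where
    rows : (Fin k → Setoid.Carrier (Bset 𝔹 n)) → Fin (suc n) → Carrier
    rows w i = from λ j → proj₁ (w j) i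

open import Data.Nat using (_≤_)

theorem5p4 : ∀ {c ℓ} (n m : ℕ) → 1 ≤ n → 1 ≤ m → (𝓑 : BooleanAlgebra c ℓ) →
    HasCard (BooleanAlgebra.setoid 𝓑) (2 ^ m) →
    HasCard (Bset 𝓑 n) ((n + 2) ^ m)
theorem5p4 n m _ _ 𝓑 card = Inverse⇒Bijection
  (≡.subst (λ size → Inverse (Bset 𝓑 n) (≡.setoid (Fin size))) (≡.cong₂ _^_ (ℕ.+-comm 2 n) atoms≡m)
    (Composition.inverse (Bset-inverse representation n) (^-inverse (Bset𝔹-inverse n) numberOfAtoms)))
  where
  open FiniteBooleanAlgebra 𝓑 (Bijection⇒Inverse card)
  atoms≡m : numberOfAtoms ≡ m
  atoms≡m = ^-injectiveʳ 2 (s≤s (s≤s z≤n)) (≡.sym size≡2^numberOfAtoms)
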